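{- Let $H$ be a graph of order at least $2$. If there exists a vertex $x$ of $H$ of degree $|V(H)|-1$ that does not belong to any $2$-adjacency basis of $H$, then $\operatorname{adim}_2(K_1+H)=\operatorname{adim}_2(H)+2$.
   Context: All graphs are finite and simple. The join $K_1+H$ is obtained from $H$ by adding a new vertex adjacent to all vertices of $H$. For a graph $G=(V,E)$, $d_{G,2}(x,y)=\min\{d_G(x,y),2\}$ with $d_G$ the shortest-path distance ($\infty$ between different components). For distinct $x,y$, $\mathcal{C}_G(x,y)=\{z\in V: d_{G,2}(x,z)\ne d_{G,2}(y,z)\}$. A set $S\subseteq V$ is a $2$-adjacency generator if $|S\cap\mathcal{C}_G(x,y)|\ge 2$ for all distinct $x,y$; a minimum one is a $2$-adjacency basis, and its cardinality is $\operatorname{adim}_2(G)$. -}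

module Defs where

open import Data.Nat using (ℕ; zero; suc; _≤_; _∸_; _+_)
open import Data.Bool using (Bool; true; false; _∧_; if_then_else_; not)
open import Data.Fin using (Fin; zero; suc; _≟_)
open import Data.Fin.Subset using (Subset; ∣_∣; _∈_)
open import Data.Vec using (tabulate; lookup)
open import Data.Product using (Σ; _×_)
open import Relation.Nullary using (¬_)
open import Relation.Nullary.Decidable using (does)
open import Relation.Binary.PropositionalEquality using (_≡_)
import Data.Nat as ℕ

record Graph (n : ℕ) : Set where
  field
    adj    : Fin n → Fin n → Bool
    sym    : ∀ i j → adj i j ≡ adj j i
    irrefl : ∀ i → adj i i ≡ false
open Graph public

degree : ∀ {n} → Graph n → Fin n → ℕ
degree G x = ∣ tabulate (λ z → adj G x z) ∣

-- d_{G,2}(x,y) = min(d_G(x,y), 2): 0 if x = y, 1 if adjacent, 2 otherwise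
-- (distance ≥ 2 or ∞ between components).
d2 : ∀ {n} → Graph n → Fin n → Fin n → ℕ
d2 G x y = if does (x ≟ y) then 0 else (if adj G x y then 1 else 2)

inC : ∀ {n} → Graph n → Fin n → Fin n → Fin n → Bool
inC G x y z = not (does (d2 G x z ℕ.≟ d2 G y z))

S∩C : ∀ {n} → Graph n → Subset n → Fin n → Fin n → Subset n
S∩C G S x y = tabulate (λ z → lookup S z ∧ inC G x y z)

Is2AdjGen : ∀ {n} → Graph n → Subset n → Set
Is2AdjGen G S = ∀ x y → ¬ (x ≡ y) → 2 ≤ ∣ S∩C G S x y ∣

Is2AdjBasis : ∀ {n} → Graph n → Subset n → Set
Is2AdjBasis G S = Is2AdjGen G S × (∀ T → Is2AdjGen G T → ∣ S ∣ ≤ ∣ T ∣)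

Adim2 : ∀ {n} → Graph n → ℕ → Set
Adim2 G k = Σ (Subset _) (λ S → Is2AdjBasis G S × ∣ S ∣ ≡ k)

joinAdj : ∀ {n} → Graph n → Fin (suc n) → Fin (suc n) → Bool
joinAdj H zero    zero    = false
joinAdj H zero    (suc j) = true
joinAdj H (suc i) zero    = true
joinAdj H (suc i) (suc j) = adj H i j

private
  joinSym : ∀ {n} (H : Graph n) i j → joinAdj H i j ≡ joinAdj H j i
  joinSym H zero zero = Relation.Binary.PropositionalEquality.refl
  joinSym H zero (suc j) = Relation.Binary.PropositionalEquality.refl
  joinSym H (suc i) zero = Relation.Binary.PropositionalEquality.refl
  joinSym H (suc i) (suc j) = sym H i j

  joinIrr : ∀ {n} (H : Graph n) i → joinAdj H i i ≡ false
  joinIrr H zero = Relation.Binary.PropositionalEquality.refl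
  joinIrr H (suc i) = irrefl H i

K1+ : ∀ {n} → Graph n → Graph (suc n)
K1+ H = record { adj = joinAdj H ; sym = joinSym H ; irrefl = joinIrr H }

-- The apex 0 of K₁ + H and the universal vertex x of H have the same distance (1) to every
-- other vertex, so only 0 and x themselves tell them apart; hence every 2-adjacency generator
-- of K₁ + H contains both, and its trace on H is a generator of H containing x.  Since x lies
-- in no basis, that trace has more than adim₂(H) elements, giving adim₂(K₁ + H) ≥ adim₂(H) + 2.
-- Conversely, for a basis S of H the set {0, x} ∪ S is a generator of K₁ + H: a pair (0, b)
-- with b ≠ x is told apart by 0 and by any vertex w ≠ x of S resolving (b, x) in H, because
-- d(0, w) = 1 = d(x, w).
module Submission where

open import Defs
open import Data.Nat using (ℕ; _≤_; _∸_; _+_)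
open import Data.Fin using (Fin)
open import Data.Fin.Subset using (Subset; _∉_)
open import Relation.Binary.PropositionalEquality using (_≡_)

open import Data.Nat using (zero; suc; z≤n; s≤s)
import Data.Nat as ℕ
open import Data.Nat.Properties using (≤-trans; ≤-reflexive; ≤∧≢⇒<; +-comm; m+n∸n≡m)
open import Data.Fin using (zero; suc; _≟_)
open import Data.Fin.Properties using (suc-injective; any?)
open import Data.Fin.Subset using (inside; outside; ∣_∣; _∈_; _⊆_; _∪_; _∩_; ∁; ⁅_⁆)
open import Data.Fin.Subset.Properties
  using (_∈?_; p⊆q⇒∣p∣≤∣q∣; ∣⁅x⁆∣≡1; x∈⁅x⁆; x∈p∧x≢y⇒x∈p-y; x∈p⇒∣p-x∣<∣p∣; x∈p∩q⁺; x∈p∩q⁻;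
         x∉p⇒x∈∁p; ∣∁p∣≡n∸∣p∣; p⊆p∪q; x∈p∪q⁺; ∪-identityʳ)
open import Data.Bool using (Bool; true; false; _∧_; not)
open import Data.Vec using (_∷_; lookup; tabulate; here; there)
open import Data.Vec.Properties
  using (lookup∘tabulate; tabulate∘lookup; tabulate-cong; lookup-zipWith; lookup⇒[]=; []=⇒lookup)
open import Data.Product using (∃; _×_; _,_; proj₁; proj₂)
open import Data.Sum using (_⊎_; inj₁; inj₂)
open import Function using (_∘_)
open import Relation.Nullary using (¬_; Dec; yes; no; does; contradiction; ¬?)
open import Relation.Nullary.Decidable using (_×-dec_; dec-true; dec-false)
open import Relation.Binary.PropositionalEquality
  using (module ≡-Reasoning; _≢_; refl; trans; cong; subst; ≢-sym) renaming (sym to ≡-sym)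

private
  variable
    n : ℕ

∈-tabulate⁺ : {f : Fin n → Bool} {i : Fin n} → f i ≡ true → i ∈ tabulate f
∈-tabulate⁺ {f = f} {i} fi = lookup⇒[]= i (tabulate f) (trans (lookup∘tabulate f i) fi)

∈-tabulate⁻ : {f : Fin n → Bool} {i : Fin n} → i ∈ tabulate f → f i ≡ true
∈-tabulate⁻ {f = f} {i} i∈ = trans (≡-sym (lookup∘tabulate f i)) ([]=⇒lookup i∈)

not-does≡true⇒¬ : ∀ {a} {A : Set a} (A? : Dec A) → not (does A?) ≡ true → ¬ A
not-does≡true⇒¬ (yes _) ()
not-does≡true⇒¬ (no ¬a) _ = ¬a

¬⇒not-does≡true : ∀ {a} {A : Set a} (A? : Dec A) → ¬ A → not (does A?) ≡ true
¬⇒not-does≡true (yes a) ¬a = contradiction a ¬a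
¬⇒not-does≡true (no _) _ = refl

x∈p∧y∈p∧x≢y⇒2≤∣p∣ : {p : Subset n} {x y : Fin n} → x ∈ p → y ∈ p → x ≢ y → 2 ≤ ∣ p ∣
x∈p∧y∈p∧x≢y⇒2≤∣p∣ x∈p y∈p x≢y =
  ≤-trans (s≤s (s≤s z≤n)) (≤-trans (s≤s (x∈p⇒∣p-x∣<∣p∣ (x∈p∧x≢y⇒x∈p-y y∈p (≢-sym x≢y)))) (x∈p⇒∣p-x∣<∣p∣ x∈p))

2≤∣p∣⇒∃x∈p-y : {p : Subset n} → 2 ≤ ∣ p ∣ → (y : Fin n) → ∃ λ x → x ∈ p × x ≢ y
2≤∣p∣⇒∃x∈p-y {p = p} 2≤∣p∣ y with any? (λ x → x ∈? p ×-dec ¬? (x ≟ y))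
... | yes found = found
... | no none = contradiction (≤-trans 2≤∣p∣ ∣p∣≤1) λ { (s≤s ()) }
  where
  p⊆⁅y⁆ : p ⊆ ⁅ y ⁆
  p⊆⁅y⁆ {x} x∈p with x ≟ y
  ... | yes refl = x∈⁅x⁆ y
  ... | no x≢y = contradiction (x , x∈p , x≢y) none

  ∣p∣≤1 : ∣ p ∣ ≤ 1
  ∣p∣≤1 = subst (∣ p ∣ ≤_) (∣⁅x⁆∣≡1 y) (p⊆q⇒∣p∣≤∣q∣ p⊆⁅y⁆)

x∉p⇒∣p∪⁅x⁆∣≡1+∣p∣ : {p : Subset n} {x : Fin n} → x ∉ p → ∣ p ∪ ⁅ x ⁆ ∣ ≡ suc ∣ p ∣
x∉p⇒∣p∪⁅x⁆∣≡1+∣p∣ {p = inside ∷ p} {zero} x∉p = contradiction here x∉p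
x∉p⇒∣p∪⁅x⁆∣≡1+∣p∣ {p = outside ∷ p} {zero} _ = cong (suc ∘ ∣_∣) (∪-identityʳ p)
x∉p⇒∣p∪⁅x⁆∣≡1+∣p∣ {p = inside ∷ p} {suc x} x∉p = cong suc (x∉p⇒∣p∪⁅x⁆∣≡1+∣p∣ (x∉p ∘ there))
x∉p⇒∣p∪⁅x⁆∣≡1+∣p∣ {p = outside ∷ p} {suc x} x∉p = x∉p⇒∣p∪⁅x⁆∣≡1+∣p∣ (x∉p ∘ there)

module _ (G : Graph n) where

  Resolves : Fin n → Fin n → Fin n → Set
  Resolves a b z = d2 G a z ≢ d2 G b z

  𝒞 : Fin n → Fin n → Subset n
  𝒞 a b = tabulate (inC G a b)

  Twins : Fin n → Fin n → Set
  Twins a b = ∀ z → Resolves a b z → z ≡ a ⊎ z ≡ b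

  d2-refl : ∀ a → d2 G a a ≡ 0
  d2-refl a rewrite dec-true (a ≟ a) refl = refl

  d2-adj : ∀ {a b} → a ≢ b → adj G a b ≡ true → d2 G a b ≡ 1
  d2-adj {a} {b} a≢b ab rewrite dec-false (a ≟ b) a≢b | ab = refl

  Resolves⇒∈𝒞 : ∀ a b {z} → Resolves a b z → z ∈ 𝒞 a b
  Resolves⇒∈𝒞 a b {z} r = ∈-tabulate⁺ (¬⇒not-does≡true (d2 G a z ℕ.≟ d2 G b z) r)

  ∈𝒞⇒Resolves : ∀ a b {z} → z ∈ 𝒞 a b → Resolves a b z
  ∈𝒞⇒Resolves a b {z} z∈𝒞 = not-does≡true⇒¬ (d2 G a z ℕ.≟ d2 G b z) (∈-tabulate⁻ z∈𝒞)

  S∩C≡S∩𝒞 : ∀ S a b → S∩C G S a b ≡ S ∩ 𝒞 a b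
  S∩C≡S∩𝒞 S a b = begin
    tabulate (λ z → lookup S z ∧ inC G a b z)
      ≡⟨ tabulate-cong (λ z → cong (lookup S z ∧_) (≡-sym (lookup∘tabulate _ z))) ⟩
    tabulate (λ z → lookup S z ∧ lookup (𝒞 a b) z)
      ≡⟨ tabulate-cong (λ z → ≡-sym (lookup-zipWith _∧_ z S (𝒞 a b))) ⟩
    tabulate (lookup (S ∩ 𝒞 a b))
      ≡⟨ tabulate∘lookup (S ∩ 𝒞 a b) ⟩
    S ∩ 𝒞 a b
      ∎
    where open ≡-Reasoning

  ∈S∩C⁺ : ∀ {S} a b {z} → z ∈ S → Resolves a b z → z ∈ S∩C G S a b
  ∈S∩C⁺ {S} a b z∈S r = subst (_ ∈_) (≡-sym (S∩C≡S∩𝒞 S a b)) (x∈p∩q⁺ (z∈S , Resolves⇒∈𝒞 a b r))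

  ∈S∩C⁻ : ∀ {S} a b {z} → z ∈ S∩C G S a b → z ∈ S × Resolves a b z
  ∈S∩C⁻ {S} a b z∈ with x∈p∩q⁻ S (𝒞 a b) (subst (_ ∈_) (S∩C≡S∩𝒞 S a b) z∈)
  ... | z∈S , z∈𝒞 = z∈S , ∈𝒞⇒Resolves a b z∈𝒞

  resolved-by-two : ∀ {S} a b {i j} → i ∈ S → j ∈ S → i ≢ j → Resolves a b i → Resolves a b j →
                    2 ≤ ∣ S∩C G S a b ∣
  resolved-by-two a b i∈S j∈S i≢j ri rj =
    x∈p∧y∈p∧x≢y⇒2≤∣p∣ (∈S∩C⁺ a b i∈S ri) (∈S∩C⁺ a b j∈S rj) i≢j

  resolver-≢ : ∀ {S} a b → 2 ≤ ∣ S∩C G S a b ∣ → ∀ c → ∃ λ z → z ∈ S × Resolves a b z × z ≢ c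
  resolver-≢ a b 2≤ c with 2≤∣p∣⇒∃x∈p-y 2≤ c
  ... | z , z∈ , z≢c with ∈S∩C⁻ a b z∈
  ...   | z∈S , r = z , z∈S , r , z≢c

  Is2AdjGen-mono : ∀ {S T} → S ⊆ T → Is2AdjGen G S → Is2AdjGen G T
  Is2AdjGen-mono {S} {T} S⊆T genS a b a≢b = ≤-trans (genS a b a≢b) (p⊆q⇒∣p∣≤∣q∣ S∩C⊆T∩C)
    where
    S∩C⊆T∩C : S∩C G S a b ⊆ S∩C G T a b
    S∩C⊆T∩C z∈ with ∈S∩C⁻ a b z∈
    ... | z∈S , r = ∈S∩C⁺ a b (S⊆T z∈S) r

  twins⇒∈generator : ∀ {S} a b → Twins a b → a ≢ b → Is2AdjGen G S → a ∈ S × b ∈ S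
  twins⇒∈generator {S} a b twins a≢b genS = member a b a≢b twins , member b a (≢-sym a≢b) twins′
    where
    twins′ : Twins b a
    twins′ z r with twins z (r ∘ ≡-sym)
    ... | inj₁ z≡a = inj₂ z≡a
    ... | inj₂ z≡b = inj₁ z≡b

    member : ∀ c d → c ≢ d → Twins c d → c ∈ S
    member c d c≢d twins-cd with resolver-≢ c d (genS c d c≢d) d
    ... | z , z∈S , r , z≢d with twins-cd z r
    ...   | inj₁ refl = z∈S
    ...   | inj₂ z≡d = contradiction z≡d z≢d

n∸[n∸1]≤1 : ∀ n → n ∸ (n ∸ 1) ≤ 1
n∸[n∸1]≤1 zero = z≤n
n∸[n∸1]≤1 (suc n) = ≤-reflexive (m+n∸n≡m 1 n)

module _ (H : Graph n) where

  Universal : Fin n → Set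
  Universal x = ∀ z → z ≢ x → adj H x z ≡ true

  degree≡n∸1⇒Universal : ∀ x → degree H x ≡ n ∸ 1 → Universal x
  degree≡n∸1⇒Universal x deg z z≢x with adj H x z in xz
  ... | true = refl
  ... | false = contradiction (≤-trans two-non-neighbours ∣∁N∣≤1) λ { (s≤s ()) }
    where
    N : Subset n
    N = tabulate (adj H x)

    ∉N : ∀ {w} → adj H x w ≡ false → w ∉ N
    ∉N xw w∈N with trans (≡-sym (∈-tabulate⁻ w∈N)) xw
    ... | ()

    two-non-neighbours : 2 ≤ ∣ ∁ N ∣
    two-non-neighbours = x∈p∧y∈p∧x≢y⇒2≤∣p∣ (x∉p⇒x∈∁p (∉N (irrefl H x))) (x∉p⇒x∈∁p (∉N xz)) (≢-sym z≢x)

    ∣∁N∣≤1 : ∣ ∁ N ∣ ≤ 1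
    ∣∁N∣≤1 = subst (_≤ 1) (≡-sym (trans (∣∁p∣≡n∸∣p∣ N) (cong (n ∸_) deg))) (n∸[n∸1]≤1 n)

  Universal⇒d2≡1 : ∀ {x w} → Universal x → w ≢ x → d2 H x w ≡ 1
  Universal⇒d2≡1 {x} {w} univ w≢x = d2-adj H (≢-sym w≢x) (univ w w≢x)

  K1+-apex-twin : ∀ {x} → Universal x → Twins (K1+ H) zero (suc x)
  K1+-apex-twin univ zero _ = inj₁ refl
  K1+-apex-twin {x} univ (suc w) r with w ≟ x
  ... | yes refl = inj₂ refl
  ... | no w≢x = contradiction (≡-sym (Universal⇒d2≡1 univ w≢x)) r

  -- Splitting on s lets the apex's entry s ∧ false in S∩C compute to false.
  K1+-restrict : ∀ {s S} → Is2AdjGen (K1+ H) (s ∷ S) → Is2AdjGen H S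
  K1+-restrict {inside} gen a b a≢b = gen (suc a) (suc b) (a≢b ∘ suc-injective)
  K1+-restrict {outside} gen a b a≢b = gen (suc a) (suc b) (a≢b ∘ suc-injective)

  K1+-extend : ∀ {x S} → Universal x → x ∈ S → Is2AdjGen H S → Is2AdjGen (K1+ H) (inside ∷ S)
  K1+-extend {x} {S} univ x∈S gen = extended
    where
    resolver : ∀ b → ∃ λ w → w ∈ S × Resolves (K1+ H) zero (suc b) (suc w)
    resolver b with b ≟ x
    ... | yes refl = x , x∈S , λ 1≡d → contradiction (trans 1≡d (d2-refl H x)) λ ()
    ... | no b≢x with resolver-≢ H b x (gen b x b≢x) x
    ...   | w , w∈S , r , w≢x = w , w∈S , λ 1≡d → r (trans (≡-sym 1≡d) (≡-sym (Universal⇒d2≡1 univ w≢x)))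

    apex-pairs : ∀ b → 2 ≤ ∣ S∩C (K1+ H) (inside ∷ S) zero (suc b) ∣
                     × 2 ≤ ∣ S∩C (K1+ H) (inside ∷ S) (suc b) zero ∣
    apex-pairs b with resolver b
    ... | w , w∈S , r = resolved-by-two (K1+ H) zero (suc b) here (there w∈S) (λ ()) (λ ()) r
                      , resolved-by-two (K1+ H) (suc b) zero here (there w∈S) (λ ()) (λ ()) (≢-sym r)

    extended : Is2AdjGen (K1+ H) (inside ∷ S)
    extended zero zero 0≢0 = contradiction refl 0≢0
    extended zero (suc b) _ = proj₁ (apex-pairs b)
    extended (suc a) zero _ = proj₂ (apex-pairs a)
    extended (suc a) (suc b) a≢b = gen a b (a≢b ∘ cong suc)

  ∣basis∣<∣generator∣ : ∀ {x S T} → (∀ B → Is2AdjBasis H B → x ∉ B) → Is2AdjBasis H S →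
                        Is2AdjGen H T → x ∈ T → suc ∣ S ∣ ≤ ∣ T ∣
  ∣basis∣<∣generator∣ {x} {S} {T} notIn (genS , minS) genT x∈T =
    ≤∧≢⇒< (minS T genT) λ ∣S∣≡∣T∣ → notIn T (genT , λ U genU → subst (_≤ ∣ U ∣) ∣S∣≡∣T∣ (minS U genU)) x∈T

  K1+-lower-bound : ∀ {x S T} → Universal x → (∀ B → Is2AdjBasis H B → x ∉ B) → Is2AdjBasis H S →
                    Is2AdjGen (K1+ H) T → 2 + ∣ S ∣ ≤ ∣ T ∣
  K1+-lower-bound {x} {S} {t ∷ T} univ notIn basis gen
    with twins⇒∈generator (K1+ H) {t ∷ T} zero (suc x) (K1+-apex-twin univ) (λ ()) gen
  ... | here , there x∈T = s≤s (∣basis∣<∣generator∣ {S = S} notIn basis (K1+-restrict {inside} {T} gen) x∈T)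

theorem39 : (n : ℕ) → 2 ≤ n → (H : Graph n) → (x : Fin n) →
    degree H x ≡ n ∸ 1 →
    (∀ (S : Subset n) → Is2AdjBasis H S → x ∉ S) →
    ∀ (k : ℕ) → Adim2 H k → Adim2 (K1+ H) (k + 2)
theorem39 n _ H x deg notIn _ (S , basis@(genS , _) , refl) =
  S′ , (genS′ , minimal) , trans ∣S′∣≡2+∣S∣ (+-comm 2 ∣ S ∣)
  where
  univ : Universal H x
  univ = degree≡n∸1⇒Universal H x deg

  S′ : Subset (suc n)
  S′ = inside ∷ (S ∪ ⁅ x ⁆)

  genS′ : Is2AdjGen (K1+ H) S′
  genS′ = K1+-extend H {S = S ∪ ⁅ x ⁆} univ (x∈p∪q⁺ (inj₂ (x∈⁅x⁆ x))) (Is2AdjGen-mono H {S} (p⊆p∪q ⁅ x ⁆) genS)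

  ∣S′∣≡2+∣S∣ : ∣ S′ ∣ ≡ 2 + ∣ S ∣
  ∣S′∣≡2+∣S∣ = cong suc (x∉p⇒∣p∪⁅x⁆∣≡1+∣p∣ (notIn S basis))

  minimal : ∀ T → Is2AdjGen (K1+ H) T → ∣ S′ ∣ ≤ ∣ T ∣
  minimal T genT = subst (_≤ ∣ T ∣) (≡-sym ∣S′∣≡2+∣S∣) (K1+-lower-bound H {S = S} {T} univ notIn basis genT)
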